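{- Let $k\ge1$ be an integer and let $S_k=\{k-1+\lfloor\log_2 n\rfloor-\log_2 n : n\ge 1,\ \nu_2(n)=k\}$. Then $S_k$ is a well-ordered subset of $\mathbb{R}$ of order type $\omega^{k-1}$.
   Context: $\nu_2(n)$ denotes the number of $1$'s in the binary expansion of the positive integer $n$. -}

module Defs where

open import Data.Nat using (ℕ; zero; suc; _+_; _*_; _^_; _<_; _≤_)
open import Data.Nat.DivMod using (_/_; _%_)
open import Data.Nat.Logarithm using (⌊log₂_⌋)
open import Data.Vec using (Vec)
open import Data.Vec.Relation.Binary.Lex.Strict using (Lex-<)
open import Relation.Binary.PropositionalEquality using (_≡_)

-- number of 1's in the binary expansion, computed with fuel
-- (fuel n suffices since n halves at each step)
popcountFuel : ℕ → ℕ → ℕ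
popcountFuel zero    n = 0
popcountFuel (suc f) n = n % 2 + popcountFuel f (n / 2)

ν₂ : ℕ → ℕ
ν₂ n = popcountFuel n n

-- For n ≥ 1 let s(n) = ⌊log₂ n⌋ - log₂ n (the constant k-1 is common to
-- all elements of S_k and irrelevant for the order).
-- s(n) < s(m)  ⇔  ⌊log₂ n⌋ + log₂ m < ⌊log₂ m⌋ + log₂ n
--              ⇔  m * 2^⌊log₂ n⌋ < n * 2^⌊log₂ m⌋   (log₂ strictly monotone)
sLt : ℕ → ℕ → Set
sLt n m = m * 2 ^ ⌊log₂ n ⌋ < n * 2 ^ ⌊log₂ m ⌋

sEq : ℕ → ℕ → Set
sEq n m = m * 2 ^ ⌊log₂ n ⌋ ≡ n * 2 ^ ⌊log₂ m ⌋

-- the ordinal ω^j realised as ℕ^j with the strict lexicographic order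
LexLt : {j : ℕ} → Vec ℕ j → Vec ℕ j → Set
LexLt = Lex-< _≡_ _<_

{-# OPTIONS --safe #-}
module Submission where

-- Reading binary expansions from the top, ν₂ n = 1 + j means exactly that
-- n = 2 ^ t * m where m has the binary digits 1 0^g₁ 1 0^g₂ … 1 0^gⱼ 1 for a
-- gap vector (g₁, …, gⱼ) ∈ ℕ^j.  The quantity s n = ⌊log₂ n⌋ - log₂ n only
-- sees the mantissa n / 2^⌊log₂ n⌋, in which it is decreasing, so it forgets
-- t; and a smaller first gap puts the second 1 higher, i.e. gives a larger
-- mantissa.  Hence the gap vectors, ordered lexicographically (type ω^j),
-- enumerate S_{1+j} in increasing order.

open import Defs
open import Data.Empty using (⊥-elim)
open import Data.Nat
open import Data.Nat.Properties
open import Data.Nat.DivMod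
open import Data.Nat.Divisibility using (m∣m*n)
open import Data.Nat.Logarithm
open import Data.Nat.Logarithm.Core using (⌊log2⌋-acc-irrelevant)
open import Data.Nat.Tactic.RingSolver using (solve-∀)
open import Data.Product using (Σ; _×_; _,_)
open import Data.Vec using (Vec; []; _∷_)
open import Data.Vec.Relation.Binary.Lex.Core using (this; next)
open import Relation.Binary.PropositionalEquality
open import Relation.Nullary using (yes; no)

n≤1+m⇒n/2≤m : ∀ {m n} → n ≤ suc m → n / 2 ≤ m
n≤1+m⇒n/2≤m {n = zero}  _     = z≤n
n≤1+m⇒n/2≤m {n = suc n} n≤1+m = <⇒≤pred (<-≤-trans (m/n<m (suc n) 2 (s≤s (s≤s z≤n))) n≤1+m)

n/2≡⌊n/2⌋ : ∀ n → n / 2 ≡ ⌊ n /2⌋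
n/2≡⌊n/2⌋ 0             = refl
n/2≡⌊n/2⌋ 1             = refl
n/2≡⌊n/2⌋ (suc (suc n)) = trans (m/n≡1+[m∸n]/n {2 + n} {2} (s≤s (s≤s z≤n))) (cong suc (n/2≡⌊n/2⌋ n))

[2^[1+e]+r]%2≡r%2 : ∀ e r → (2 ^ suc e + r) % 2 ≡ r % 2
[2^[1+e]+r]%2≡r%2 e r = %-remove-+ˡ r (m∣m*n (2 ^ e))

[2^[1+e]+r]/2≡2^e+r/2 : ∀ e r → (2 ^ suc e + r) / 2 ≡ 2 ^ e + r / 2
[2^[1+e]+r]/2≡2^e+r/2 e r = begin
  (2 ^ suc e + r) / 2     ≡⟨ +-distrib-/-∣ˡ r (m∣m*n (2 ^ e)) ⟩
  2 * 2 ^ e / 2 + r / 2   ≡⟨ cong (λ x → x / 2 + r / 2) (*-comm 2 (2 ^ e)) ⟩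
  2 ^ e * 2 / 2 + r / 2   ≡⟨ cong (_+ r / 2) (m*n/n≡m (2 ^ e) 2) ⟩
  2 ^ e + r / 2           ∎
  where open ≡-Reasoning

r<2^[1+e]⇒r/2<2^e : ∀ {e r} → r < 2 ^ suc e → r / 2 < 2 ^ e
r<2^[1+e]⇒r/2<2^e {e} {r} r<2^[1+e] = m<n*o⇒m/o<n (subst (r <_) (*-comm 2 (2 ^ e)) r<2^[1+e])

m^n<m^o⇒n<o : ∀ m .{{_ : NonZero m}} {n o} → m ^ n < m ^ o → n < o
m^n<m^o⇒n<o m m^n<m^o = ≰⇒> (λ o≤n → <⇒≱ m^n<m^o (^-monoʳ-≤ m o≤n))

popcountFuel-irrelevant : ∀ {f g n} → n ≤ f → n ≤ g → popcountFuel f n ≡ popcountFuel g n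
popcountFuel-irrelevant {zero}  {zero}  z≤n _   = refl
popcountFuel-irrelevant {zero}  {suc g} z≤n _   = popcountFuel-irrelevant {zero} {g} z≤n z≤n
popcountFuel-irrelevant {suc f} {zero}  _   z≤n = popcountFuel-irrelevant {f} {zero} z≤n z≤n
popcountFuel-irrelevant {suc f} {suc g} {n} n≤1+f n≤1+g =
  cong (n % 2 +_) (popcountFuel-irrelevant (n≤1+m⇒n/2≤m n≤1+f) (n≤1+m⇒n/2≤m n≤1+g))

ν₂-step : ∀ n → ν₂ n ≡ n % 2 + ν₂ (n / 2)
ν₂-step zero    = refl
ν₂-step (suc m) = cong (suc m % 2 +_) (popcountFuel-irrelevant {m} (n≤1+m⇒n/2≤m {m} ≤-refl) ≤-refl)

⌊log₂⌋-step : ∀ n → 2 ≤ n → ⌊log₂ n ⌋ ≡ suc ⌊log₂ (n / 2) ⌋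
⌊log₂⌋-step (suc zero)    (s≤s ())
⌊log₂⌋-step (suc (suc n)) _         =
  cong suc (trans (⌊log2⌋-acc-irrelevant (suc ⌊ n /2⌋)) (cong ⌊log₂_⌋ (sym (n/2≡⌊n/2⌋ (2 + n)))))

ν₂[2^e+r]≡1+ν₂[r] : ∀ e {r} → r < 2 ^ e → ν₂ (2 ^ e + r) ≡ suc (ν₂ r)
ν₂[2^e+r]≡1+ν₂[r] zero    {zero}  _         = refl
ν₂[2^e+r]≡1+ν₂[r] zero    {suc r} (s≤s ())
ν₂[2^e+r]≡1+ν₂[r] (suc e) {r} r<2^[1+e] = begin
  ν₂ (2 ^ suc e + r)
    ≡⟨ ν₂-step (2 ^ suc e + r) ⟩
  (2 ^ suc e + r) % 2 + ν₂ ((2 ^ suc e + r) / 2)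
    ≡⟨ cong₂ (λ b m → b + ν₂ m) ([2^[1+e]+r]%2≡r%2 e r) ([2^[1+e]+r]/2≡2^e+r/2 e r) ⟩
  r % 2 + ν₂ (2 ^ e + r / 2)
    ≡⟨ cong (r % 2 +_) (ν₂[2^e+r]≡1+ν₂[r] e (r<2^[1+e]⇒r/2<2^e {e} r<2^[1+e])) ⟩
  r % 2 + suc (ν₂ (r / 2))
    ≡⟨ +-suc (r % 2) (ν₂ (r / 2)) ⟩
  suc (r % 2 + ν₂ (r / 2))
    ≡⟨ cong suc (sym (ν₂-step r)) ⟩
  suc (ν₂ r) ∎
  where open ≡-Reasoning

⌊log₂[2^e+r]⌋≡e : ∀ e {r} → r < 2 ^ e → ⌊log₂ (2 ^ e + r) ⌋ ≡ e
⌊log₂[2^e+r]⌋≡e zero    {zero}  _         = refl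
⌊log₂[2^e+r]⌋≡e zero    {suc r} (s≤s ())
⌊log₂[2^e+r]⌋≡e (suc e) {r} r<2^[1+e] = begin
  ⌊log₂ (2 ^ suc e + r) ⌋         ≡⟨ ⌊log₂⌋-step _ 2≤2^[1+e]+r ⟩
  suc ⌊log₂ ((2 ^ suc e + r) / 2) ⌋ ≡⟨ cong (λ m → suc ⌊log₂ m ⌋) ([2^[1+e]+r]/2≡2^e+r/2 e r) ⟩
  suc ⌊log₂ (2 ^ e + r / 2) ⌋     ≡⟨ cong suc (⌊log₂[2^e+r]⌋≡e e (r<2^[1+e]⇒r/2<2^e {e} r<2^[1+e])) ⟩
  suc e                           ∎
  where
  open ≡-Reasoning
  2≤2^[1+e]+r : 2 ≤ 2 ^ suc e + r
  2≤2^[1+e]+r = ≤-trans (^-monoʳ-≤ 2 {1} {suc e} (s≤s z≤n)) (m≤m+n (2 ^ suc e) r)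

topBit-decomposition : ∀ n → 1 ≤ n → Σ ℕ λ L → Σ ℕ λ r → n ≡ 2 ^ L + r × r < 2 ^ L
topBit-decomposition (suc zero)    _ = 0 , 0 , refl , s≤s z≤n
topBit-decomposition (suc (suc m)) _ with topBit-decomposition (suc m) (s≤s z≤n)
... | L , r , 1+m≡2^L+r , r<2^L with suc r <? 2 ^ L
...   | yes 1+r<2^L = L , suc r , trans (cong suc 1+m≡2^L+r) (sym (+-suc (2 ^ L) r)) , 1+r<2^L
...   | no  1+r≮2^L = suc L , 0 , 2+m≡2^[1+L]+0 , m^n>0 2 (suc L)
  where
  2+m≡2^[1+L]+0 : suc (suc m) ≡ 2 ^ suc L + 0
  2+m≡2^[1+L]+0 = begin
    suc (suc m)            ≡⟨ cong suc 1+m≡2^L+r ⟩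
    suc (2 ^ L + r)        ≡⟨ sym (+-suc (2 ^ L) r) ⟩
    2 ^ L + suc r          ≡⟨ cong (2 ^ L +_) (≤-antisym r<2^L (≮⇒≥ 1+r≮2^L)) ⟩
    2 ^ L + 2 ^ L          ≡⟨ cong (2 ^ L +_) (sym (+-identityʳ (2 ^ L))) ⟩
    2 ^ L + (2 ^ L + 0)    ≡⟨ sym (+-identityʳ _) ⟩
    2 ^ suc L + 0          ∎
    where open ≡-Reasoning

ν₂[1+n]≢0 : ∀ n → ν₂ (suc n) ≢ 0
ν₂[1+n]≢0 n ν₂≡0 with topBit-decomposition (suc n) (s≤s z≤n)
... | L , r , eq , r<2^L = 0≢1+n (trans (sym ν₂≡0) (trans (cong ν₂ eq) (ν₂[2^e+r]≡1+ν₂[r] L r<2^L)))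

⌊log₂[2^t*n]⌋≡t+⌊log₂n⌋ : ∀ t n .{{_ : NonZero n}} → ⌊log₂ (2 ^ t * n) ⌋ ≡ t + ⌊log₂ n ⌋
⌊log₂[2^t*n]⌋≡t+⌊log₂n⌋ zero    n = cong ⌊log₂_⌋ (+-identityʳ n)
⌊log₂[2^t*n]⌋≡t+⌊log₂n⌋ (suc t) n = begin
  ⌊log₂ (2 * 2 ^ t * n) ⌋     ≡⟨ cong ⌊log₂_⌋ (*-assoc 2 (2 ^ t) n) ⟩
  ⌊log₂ (2 * (2 ^ t * n)) ⌋   ≡⟨ ⌊log₂[2*b]⌋≡1+⌊log₂b⌋ (2 ^ t * n) {{m*n≢0 (2 ^ t) n {{m^n≢0 2 t}}}} ⟩
  suc ⌊log₂ (2 ^ t * n) ⌋     ≡⟨ cong suc (⌊log₂[2^t*n]⌋≡t+⌊log₂n⌋ t n) ⟩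
  suc (t + ⌊log₂ n ⌋)         ∎
  where open ≡-Reasoning

sEq-2^* : ∀ t n .{{_ : NonZero n}} → sEq n (2 ^ t * n)
sEq-2^* t n = begin
  2 ^ t * n * 2 ^ ⌊log₂ n ⌋     ≡⟨ cong (_* 2 ^ ⌊log₂ n ⌋) (*-comm (2 ^ t) n) ⟩
  n * 2 ^ t * 2 ^ ⌊log₂ n ⌋     ≡⟨ *-assoc n (2 ^ t) (2 ^ ⌊log₂ n ⌋) ⟩
  n * (2 ^ t * 2 ^ ⌊log₂ n ⌋)   ≡⟨ cong (n *_) (sym (^-distribˡ-+-* 2 t ⌊log₂ n ⌋)) ⟩
  n * 2 ^ (t + ⌊log₂ n ⌋)       ≡⟨ cong (λ e → n * 2 ^ e) (sym (⌊log₂[2^t*n]⌋≡t+⌊log₂n⌋ t n)) ⟩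
  n * 2 ^ ⌊log₂ (2 ^ t * n) ⌋   ∎
  where open ≡-Reasoning

-- fromGaps (g₁ ∷ … ∷ gⱼ) has binary expansion 1 0^g₁ 1 0^g₂ … 1 0^gⱼ 1,
-- whose leading digit sits at position topBit (g₁ ∷ … ∷ gⱼ).
topBit : ∀ {j} → Vec ℕ j → ℕ
topBit []       = 0
topBit (g ∷ gs) = suc (g + topBit gs)

fromGaps : ∀ {j} → Vec ℕ j → ℕ
fromGaps []       = 1
fromGaps (g ∷ gs) = 2 ^ topBit (g ∷ gs) + fromGaps gs

fromGaps<2^[1+topBit] : ∀ {j} (gs : Vec ℕ j) → fromGaps gs < 2 ^ suc (topBit gs)
fromGaps-tail<2^topBit : ∀ {j} g (gs : Vec ℕ j) → fromGaps gs < 2 ^ topBit (g ∷ gs)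

fromGaps<2^[1+topBit] []       = s≤s (s≤s z≤n)
fromGaps<2^[1+topBit] (g ∷ gs) =
  subst (fromGaps (g ∷ gs) <_) (cong (2 ^ T +_) (sym (+-identityʳ (2 ^ T))))
        (+-monoʳ-< (2 ^ T) (fromGaps-tail<2^topBit g gs))
  where T = topBit (g ∷ gs)

fromGaps-tail<2^topBit g gs =
  <-≤-trans (fromGaps<2^[1+topBit] gs) (^-monoʳ-≤ 2 (s≤s (m≤n+m (topBit gs) g)))

2^topBit≤fromGaps : ∀ {j} (gs : Vec ℕ j) → 2 ^ topBit gs ≤ fromGaps gs
2^topBit≤fromGaps []       = ≤-refl
2^topBit≤fromGaps (g ∷ gs) = m≤m+n _ (fromGaps gs)

0<fromGaps : ∀ {j} (gs : Vec ℕ j) → 0 < fromGaps gs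
0<fromGaps gs = <-≤-trans (m^n>0 2 (topBit gs)) (2^topBit≤fromGaps gs)

ν₂-fromGaps : ∀ {j} (gs : Vec ℕ j) → ν₂ (fromGaps gs) ≡ suc j
ν₂-fromGaps []       = refl
ν₂-fromGaps (g ∷ gs) =
  trans (ν₂[2^e+r]≡1+ν₂[r] (topBit (g ∷ gs)) (fromGaps-tail<2^topBit g gs)) (cong suc (ν₂-fromGaps gs))

⌊log₂fromGaps⌋≡topBit : ∀ {j} (gs : Vec ℕ j) → ⌊log₂ fromGaps gs ⌋ ≡ topBit gs
⌊log₂fromGaps⌋≡topBit []       = refl
⌊log₂fromGaps⌋≡topBit (g ∷ gs) = ⌊log₂[2^e+r]⌋≡e (topBit (g ∷ gs)) (fromGaps-tail<2^topBit g gs)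

-- As fractions: q / V < p / U implies 1 + q / (P V) < 1 + p / (P U).
q*U<p*V⇒[PV+q]*PU<[PU+p]*PV : ∀ P U V p q .{{_ : NonZero P}} → q * U < p * V →
                              (P * V + q) * (P * U) < (P * U + p) * (P * V)
q*U<p*V⇒[PV+q]*PU<[PU+p]*PV P U V p q q*U<p*V =
  subst₂ _<_ (sym (expandˡ P U V q)) (sym (expandʳ P U V p))
    (+-monoʳ-< (P * V * (P * U)) (*-monoʳ-< P q*U<p*V))
  where
  expandˡ : ∀ P U V q → (P * V + q) * (P * U) ≡ P * V * (P * U) + P * (q * U)
  expandˡ = solve-∀
  expandʳ : ∀ P U V p → (P * U + p) * (P * V) ≡ P * V * (P * U) + P * (p * V)
  expandʳ = solve-∀

fromGaps-lexMono : ∀ {j} {as bs : Vec ℕ j} → LexLt as bs →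
                   fromGaps bs * 2 ^ topBit as < fromGaps as * 2 ^ topBit bs
fromGaps-lexMono {as = g ∷ gs} {h ∷ hs} (this g<h _) = begin-strict
  (Y + fromGaps hs) * X           ≡⟨ *-distribʳ-+ X Y (fromGaps hs) ⟩
  Y * X + fromGaps hs * X         <⟨ +-monoʳ-< (Y * X) (*-monoˡ-< X {{m^n≢0 2 (topBit (g ∷ gs))}} (fromGaps<2^[1+topBit] hs)) ⟩
  Y * X + 2 ^ suc B * X           ≤⟨ +-monoʳ-≤ (Y * X) 2^[1+B]*X≤2^A*Y ⟩
  Y * X + 2 ^ A * Y               ≤⟨ +-monoʳ-≤ (Y * X) (*-monoˡ-≤ Y (2^topBit≤fromGaps gs)) ⟩
  Y * X + fromGaps gs * Y         ≡⟨ cong (_+ fromGaps gs * Y) (*-comm Y X) ⟩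
  X * Y + fromGaps gs * Y         ≡⟨ *-distribʳ-+ Y X (fromGaps gs) ⟨
  (X + fromGaps gs) * Y           ∎
  where
  open ≤-Reasoning
  A = topBit gs
  B = topBit hs
  X = 2 ^ topBit (g ∷ gs)
  Y = 2 ^ topBit (h ∷ hs)
  rearrange : ∀ g A B → suc B + suc (g + A) ≡ A + suc (suc g + B)
  rearrange = solve-∀
  exponent≤ : suc B + suc (g + A) ≤ A + suc (h + B)
  exponent≤ = subst (_≤ A + suc (h + B)) (sym (rearrange g A B)) (+-monoʳ-≤ A (s≤s (+-monoˡ-≤ B g<h)))
  2^[1+B]*X≤2^A*Y : 2 ^ suc B * X ≤ 2 ^ A * Y
  2^[1+B]*X≤2^A*Y = subst₂ _≤_ (^-distribˡ-+-* 2 (suc B) _) (^-distribˡ-+-* 2 A _) (^-monoʳ-≤ 2 exponent≤)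
fromGaps-lexMono {as = g ∷ gs} {.g ∷ hs} (next refl gs<hs) =
  subst₂ (λ U V → (V + fromGaps hs) * U < (U + fromGaps gs) * V)
    (sym (^-distribˡ-+-* 2 (suc g) (topBit gs))) (sym (^-distribˡ-+-* 2 (suc g) (topBit hs)))
    (q*U<p*V⇒[PV+q]*PU<[PU+p]*PV (2 ^ suc g) (2 ^ topBit gs) (2 ^ topBit hs) (fromGaps gs) (fromGaps hs)
       {{m^n≢0 2 (suc g)}} (fromGaps-lexMono gs<hs))

2^t*fromGaps<2^L⇒t+topBit<L : ∀ {j} L t (gs : Vec ℕ j) → 2 ^ t * fromGaps gs < 2 ^ L → t + topBit gs < L
2^t*fromGaps<2^L⇒t+topBit<L L t gs r<2^L = m^n<m^o⇒n<o 2 (≤-<-trans 2^[t+A]≤r r<2^L)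
  where
  A = topBit gs
  2^[t+A]≤r : 2 ^ (t + A) ≤ 2 ^ t * fromGaps gs
  2^[t+A]≤r = subst (_≤ 2 ^ t * fromGaps gs) (sym (^-distribˡ-+-* 2 t A))
                    (*-monoʳ-≤ (2 ^ t) (2^topBit≤fromGaps gs))

prependGap : ∀ {j} L t (gs : Vec ℕ j) → 2 ^ t * fromGaps gs < 2 ^ L →
             Σ ℕ λ k → 2 ^ L + 2 ^ t * fromGaps gs ≡ 2 ^ t * fromGaps (k ∷ gs)
prependGap L t gs r<2^L with m≤n⇒∃[o]m+o≡n (2^t*fromGaps<2^L⇒t+topBit<L L t gs r<2^L)
... | k , refl = k , (begin
  2 ^ (suc (t + A) + k) + 2 ^ t * fromGaps gs
    ≡⟨ cong (λ e → 2 ^ e + 2 ^ t * fromGaps gs) (rearrange t A k) ⟩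
  2 ^ (t + suc (k + A)) + 2 ^ t * fromGaps gs
    ≡⟨ cong (_+ 2 ^ t * fromGaps gs) (^-distribˡ-+-* 2 t (suc (k + A))) ⟩
  2 ^ t * 2 ^ suc (k + A) + 2 ^ t * fromGaps gs
    ≡⟨ *-distribˡ-+ (2 ^ t) _ (fromGaps gs) ⟨
  2 ^ t * fromGaps (k ∷ gs) ∎)
  where
  open ≡-Reasoning
  A = topBit gs
  rearrange : ∀ t A k → suc (t + A) + k ≡ t + suc (k + A)
  rearrange = solve-∀

ν₂≡1+j⇒≡2^t*fromGaps : ∀ j n → 1 ≤ n → ν₂ n ≡ suc j →
                        Σ (Vec ℕ j) λ gs → Σ ℕ λ t → n ≡ 2 ^ t * fromGaps gs
ν₂≡1+j⇒≡2^t*fromGaps j n 1≤n ν₂n≡1+j with topBit-decomposition n 1≤n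
... | L , r , refl , r<2^L = lowBits j r r<2^L (suc-injective (trans (sym (ν₂[2^e+r]≡1+ν₂[r] L r<2^L)) ν₂n≡1+j))
  where
  lowBits : ∀ j r → r < 2 ^ L → ν₂ r ≡ j →
            Σ (Vec ℕ j) λ gs → Σ ℕ λ t → 2 ^ L + r ≡ 2 ^ t * fromGaps gs
  lowBits zero    zero    _     _       = [] , L , trans (+-identityʳ _) (sym (*-identityʳ _))
  lowBits zero    (suc r) _     ν₂≡0    = ⊥-elim (ν₂[1+n]≢0 r ν₂≡0)
  lowBits (suc j) (suc r) r<2^L ν₂r≡1+j with ν₂≡1+j⇒≡2^t*fromGaps j (suc r) (s≤s z≤n) ν₂r≡1+j
  ... | gs , t , r≡2^t*F with prependGap L t gs (subst (_< 2 ^ L) r≡2^t*F r<2^L)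
  ...   | k , eq = k ∷ gs , t , trans (cong (2 ^ L +_) r≡2^t*F) eq

proposition6p2 : (j : ℕ) →
    Σ (Vec ℕ j → ℕ) λ f →
      ((a : Vec ℕ j) → (1 ≤ f a) × (ν₂ (f a) ≡ suc j))
      × ((a b : Vec ℕ j) → LexLt a b → sLt (f a) (f b))
      × ((n : ℕ) → 1 ≤ n → ν₂ n ≡ suc j → Σ (Vec ℕ j) λ a → sEq (f a) n)
proposition6p2 j = fromGaps , (λ gs → 0<fromGaps gs , ν₂-fromGaps gs) , increasing , onto
  where
  increasing : (as bs : Vec ℕ j) → LexLt as bs → sLt (fromGaps as) (fromGaps bs)
  increasing as bs as<bs rewrite ⌊log₂fromGaps⌋≡topBit as | ⌊log₂fromGaps⌋≡topBit bs =
    fromGaps-lexMono as<bs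
  onto : (n : ℕ) → 1 ≤ n → ν₂ n ≡ suc j → Σ (Vec ℕ j) λ gs → sEq (fromGaps gs) n
  onto n 1≤n ν₂n≡1+j with ν₂≡1+j⇒≡2^t*fromGaps j n 1≤n ν₂n≡1+j
  ... | gs , t , refl = gs , sEq-2^* t (fromGaps gs) {{>-nonZero (0<fromGaps gs)}}
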